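{- Let $P=([n],\preceq)$ be a poset, $w$ a weight on $\mathbb{F}_q$, $\pi(i)=k_i$ a label map with $N=k_1+\cdots+k_n$, and let $\mathbb{C}\subseteq\mathbb{F}_q^N$ be a code with $|\mathbb{C}|\ge2$ and minimum distance $d_{(P,w,\pi)}(\mathbb{C})$. Let $r=\big\lfloor\frac{d_{(P,w,\pi)}(\mathbb{C})-1}{M_w}\big\rfloor$. Then $$\max_{J\in\mathcal{I}^r}\Big\{\sum_{i\in J}k_i\Big\}\le N-\lceil\log_q|\mathbb{C}|\rceil.$$
   Context: A weight on $\mathbb{F}_q$ is a map $w:\mathbb{F}_q\to\mathbb{N}\cup\{0\}$ with $w(\alpha)=0$ iff $\alpha=0$, $w(-\alpha)=w(\alpha)$, $w(\alpha+\beta)\le w(\alpha)+w(\beta)$; $M_w=\max_\alpha w(\alpha)$; $\tilde w^k(v)=\max_s w(v_s)$ for $v\in\mathbb{F}_q^k$. Ideals of $P$ are down-closed subsets; $\langle A\rangle$ is the ideal generated by $A$; $\mathcal{I}^r$ is the set of ideals of $P$ of cardinality $r$. Writing $x=x_1\oplus\cdots\oplus x_n\in\mathbb{F}_q^{k_1}\oplus\cdots\oplus\mathbb{F}_q^{k_n}$, $supp_\pi(x)=\{i:x_i\ne0\}$, $I_x=\langle supp_\pi(x)\rangle$, $M_x$ the set of maximal elements of $I_x$, $w_{(P,w,\pi)}(x)=\sum_{i\in M_x}\tilde w^{k_i}(x_i)+|I_x\setminus M_x|\,M_w$, $d_{(P,w,\pi)}(x,y)=w_{(P,w,\pi)}(x-y)$,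 and $d_{(P,w,\pi)}(\mathbb{C})=\min\{d_{(P,w,\pi)}(c_1,c_2):c_1\ne c_2\in\mathbb{C}\}$. -}

module Defs where

open import Level using (0ℓ)
open import Data.Nat using (ℕ; zero; suc; _+_; _*_; _∸_; _^_; _≤_; _/_; _⊔_; _≤ᵇ_)
open import Data.Bool using (Bool; true; false; if_then_else_; _∧_)
open import Data.Fin using (Fin)
open import Data.Fin.Subset using (Subset; _∈_; ∣_∣; _─_)
open import Data.Vec using (Vec; lookup; tabulate; allFin; foldr)
import Data.Vec as V
open import Data.Vec.Properties using (≡-dec)
open import Data.List using (List)
open import Data.List.Membership.Propositional using () renaming (_∈_ to _∈ˡ_)
open import Data.Product using (Σ; ∃; _×_; _,_)
open import Relation.Nullary using (¬_; does)
open import Relation.Binary using (Rel; Decidable; IsPartialOrder)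
open import Relation.Binary.PropositionalEquality using (_≡_; _≢_)
open import Algebra.Structures using (IsCommutativeRing)
import Data.Fin.Properties as FinP
open import Function.Bundles using (_⇔_)

record FiniteField (q : ℕ) : Set where
  field
    _+F_ _*F_ : Fin q → Fin q → Fin q
    -F_       : Fin q → Fin q
    0F 1F     : Fin q
    isCommutativeRing : IsCommutativeRing _≡_ _+F_ _*F_ -F_ 0F 1F
    0≢1 : 0F ≢ 1F
    inverse : ∀ a → a ≢ 0F → ∃ λ b → a *F b ≡ 1F
  _-F_ : Fin q → Fin q → Fin q
  a -F b = a +F (-F b)

record Weight {q : ℕ} (F : FiniteField q) : Set where
  open FiniteField F
  field
    w : Fin q → ℕ
    w-zero : ∀ α → (w α ≡ 0) ⇔ (α ≡ 0F)
    w-neg  : ∀ α → w (-F α) ≡ w α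
    w-tri  : ∀ α β → w (α +F β) ≤ w α + w β

module _ {q : ℕ} {F : FiniteField q} (W : Weight F) where
  open Weight W

  Mw : ℕ
  Mw = foldr (λ _ → ℕ) (λ α m → w α ⊔ m) 0 (allFin q)

  w̃ : ∀ {k} → Vec (Fin q) k → ℕ
  w̃ v = foldr (λ _ → ℕ) (λ a m → w a ⊔ m) 0 v

record FinPoset (n : ℕ) : Set₁ where
  field
    _≼_ : Rel (Fin n) 0ℓ
    isPartialOrder : IsPartialOrder _≡_ _≼_
    _≼?_ : Decidable _≼_

IsIdeal : ∀ {n} → FinPoset n → Subset n → Set
IsIdeal P J = ∀ i j → j ∈ J → i ≼ j → i ∈ J
  where open FinPoset P

sumOver : ∀ {n} → Subset n → (Fin n → ℕ) → ℕ
sumOver {n} S f = foldr (λ _ → ℕ) (λ i acc → (if lookup S i then f i else 0) + acc) 0 (allFin n)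

-- Words of F_q^{k_1} ⊕ ... ⊕ F_q^{k_n}, with label map π(i) = k i.

Word : (q n : ℕ) → (Fin n → ℕ) → Set
Word q n k = (i : Fin n) → Vec (Fin q) (k i)

N : ∀ {n} → (Fin n → ℕ) → ℕ
N {n} k = foldr (λ _ → ℕ) (λ i acc → k i + acc) 0 (allFin n)

module _ {q n : ℕ} {F : FiniteField q} (W : Weight F) (P : FinPoset n) (k : Fin n → ℕ) where
  open FiniteField F
  open FinPoset P

  isNonzeroBlock : Word q n k → Fin n → Bool
  isNonzeroBlock x i = if does (≡-dec FinP._≟_ (x i) (V.replicate (k i) 0F)) then false else true

  suppπ : Word q n k → Subset n
  suppπ x = tabulate (isNonzeroBlock x)

  Ix : Word q n k → Subset n
  Ix x = tabulate λ i → foldr (λ _ → Bool)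
           (λ j b → (isNonzeroBlock x j ∧ does (i ≼? j)) Data.Bool.∨ b) false (allFin n)

  -- M_x : maximal elements of I_x
  Mx : Word q n k → Subset n
  Mx x = tabulate λ i → lookup (Ix x) i ∧
           foldr (λ _ → Bool)
             (λ j b → (if (lookup (Ix x) j ∧ does (i ≼? j) ∧
                           (if does (i FinP.≟ j) then false else true))
                       then false else true) ∧ b) true (allFin n)

  wPwπ : Word q n k → ℕ
  wPwπ x = sumOver (Mx x) (λ i → w̃ W (x i)) + ∣ Ix x ─ Mx x ∣ * Mw W

  dPwπ : Word q n k → Word q n k → ℕ
  dPwπ x y = wPwπ (λ i → V.zipWith _-F_ (x i) (y i))

  IsMinDist : List (Word q n k) → ℕ → Set
  IsMinDist C d =
    (Σ (Word q n k) λ c₁ → Σ (Word q n k) λ c₂ →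
        c₁ ∈ˡ C × c₂ ∈ˡ C × c₁ ≢ c₂ × dPwπ c₁ c₂ ≡ d)
    × (∀ c₁ c₂ → c₁ ∈ˡ C → c₂ ∈ˡ C → c₁ ≢ c₂ → d ≤ dPwπ c₁ c₂)

-- ⌊ a / b ⌋ (with the convention ⌊ a / 0 ⌋ = 0, never used since M_w ≥ 1)

⌊_/_⌋ : ℕ → ℕ → ℕ
⌊ a / zero ⌋ = 0
⌊ a / suc b ⌋ = a / suc b

-- ⌈ log_q x ⌉ : least m with x ≤ q^m (searched for m ≤ x, enough for q ≥ 2)
⌈log_⌉ : ℕ → ℕ → ℕ
⌈log q ⌉ x = go x 0
  where
  go : ℕ → ℕ → ℕ
  go zero m = m
  go (suc f) m = if x ≤ᵇ q ^ m then m else go f (suc m)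

{-# OPTIONS --safe #-}
-- Let J be an ideal with |J| = r = ⌊(d − 1)/M_w⌋, so |J|·M_w < d.  If a word x is supported
-- in J then so is the ideal I_x it generates, and every element of I_x contributes at most M_w
-- to the (P,w,π)-weight; hence the weight of x is at most |J|·M_w < d.  So two distinct
-- codewords never agree on all blocks outside J: projecting C onto those blocks, which span
-- N − Σ_{i∈J} k_i coordinates, is injective, and |C| ≤ q^(N − Σ_{i∈J} k_i).

module Submission where

open import Defs
open import Data.Nat using (ℕ; _≤_; _∸_)
open import Data.Fin using (Fin)
open import Data.Fin.Subset using (Subset; ∣_∣)
open import Data.List using (List; length)
open import Data.List.Relation.Unary.Unique.Propositional using (Unique)
open import Relation.Binary.PropositionalEquality using (_≡_)

open import Data.Nat using (zero; suc; _+_; _*_; _^_; _<_; _⊔_; z≤n; s≤s; _≤ᵇ_; _≤?_)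
open import Data.Nat.Properties
open import Data.Nat.DivMod using (m/n*n≤m; 0/n≡0)
open import Algebra.Properties.Monoid.Sum +-0-monoid using (sum)
open import Algebra.Properties.CommutativeSemigroup +-commutativeSemigroup using (x∙yz≈y∙xz)
open import Data.Bool using (Bool; true; false; if_then_else_; _∧_; _∨_; T)
open import Data.Bool.Properties using (∧-conicalˡ; ∧-conicalʳ)
open import Data.Fin using () renaming (zero to fzero; suc to fsuc)
open import Data.Fin.Properties using (pigeonhole; finToFun-funToFin)
open import Data.Fin.Base using (funToFin; finToFun)
open import Data.Fin.Subset using (_⊆_; _∈_; _─_; ∁)
open import Data.Fin.Subset.Properties using (drop-∷-⊆; p⊆q⇒∣p∣≤∣q∣; x∉p⇒x∈∁p; _∈?_)
open import Data.Vec using (Vec; []; _∷_; here; lookup; tabulate; foldr; _++_; replicate; zipWith)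
open import Data.Vec.Properties
  using (lookup∘tabulate; []=⇒lookup; lookup⇒[]=; ++-injectiveˡ; ++-injectiveʳ; ≡-dec; tabulate∘lookup; tabulate-cong)
import Data.Fin.Properties as FinP
import Data.List as List
open import Data.List.Membership.Propositional using () renaming (_∈_ to _∈ˡ_)
open import Data.List.Membership.Propositional.Properties using (∈-lookup)
import Data.List.Relation.Unary.All as All
open import Data.List.Relation.Unary.AllPairs using ([]; _∷_)
open import Data.Product using (∃; _,_)
open import Data.Empty using (⊥-elim)
open import Function.Definitions using (Injective)
open import Function.Base using (_∘_)
open import Relation.Nullary using (Dec; yes; no; does; contradiction)
open import Relation.Binary.PropositionalEquality using (refl; sym; trans; cong; cong₂; subst; _≢_; ≢-sym; module ≡-Reasoning)
open import Algebra.Structures using (IsCommutativeRing)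

-- ⌈log_⌉ runs a search bound in a where-block, which cannot be named from here.  We name it
-- as the solution of a metavariable, fixed by one unfolding step; the with-abstraction turns
-- the arguments into variables so that the unification problem is a pattern.
module _ (q : ℕ) where
  private
    mutual
      search : ℕ → ℕ → ℕ → ℕ
      search = _

      ⌈log⌉-suc : ∀ y → ⌈log q ⌉ (suc y) ≡ (if suc y ≤ᵇ 1 then 0 else search (suc y) y 1)
      ⌈log⌉-suc y with suc y | 1
      ... | x | m = refl

    ⌈log⌉≡search : ∀ x → ⌈log q ⌉ x ≡ search x x 0
    ⌈log⌉≡search zero = refl
    ⌈log⌉≡search (suc y) = ⌈log⌉-suc y

    search-≤ : ∀ {x M} → x ≤ q ^ M → ∀ f {m} → m ≤ M → search x f m ≤ M
    search-≤ x≤q^M zero m≤M = m≤M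
    search-≤ {x} {M} x≤q^M (suc f) {m} m≤M with x ≤ᵇ q ^ m in eq
    ... | true = m≤M
    ... | false = search-≤ x≤q^M f (≤∧≢⇒< m≤M m≢M)
      where
      m≢M : m ≢ M
      m≢M refl = subst T eq (≤⇒≤ᵇ x≤q^M)

  ⌈log⌉-least : ∀ {x M} → x ≤ q ^ M → ⌈log q ⌉ x ≤ M
  ⌈log⌉-least {x} x≤q^M = subst (_≤ _) (sym (⌈log⌉≡search x)) (search-≤ x≤q^M x z≤n)

does≡true⇒ : ∀ {A : Set} (a? : Dec A) → does a? ≡ true → A
does≡true⇒ (yes a) _ = a

foldr-⊔-tabulate-≥ : ∀ {A : Set} {n} (g : A → ℕ) (h : Fin n → A) j →
  g (h j) ≤ foldr (λ _ → ℕ) (λ a m → g a ⊔ m) 0 (tabulate h)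
foldr-⊔-tabulate-≥ g h fzero = m≤m⊔n _ _
foldr-⊔-tabulate-≥ g h (fsuc j) = ≤-trans (foldr-⊔-tabulate-≥ g (h ∘ fsuc) j) (m≤n⊔m _ _)

foldr-∨-tabulate-true : ∀ {A : Set} {n} (g : A → Bool) (h : Fin n → A) →
  foldr (λ _ → Bool) (λ a b → g a ∨ b) false (tabulate h) ≡ true → ∃ λ i → g (h i) ≡ true
foldr-∨-tabulate-true {n = suc n} g h any≡true with g (h fzero) in eq
... | true = fzero , eq
... | false with foldr-∨-tabulate-true g (h ∘ fsuc) any≡true
...   | i , gᵢ≡true = fsuc i , gᵢ≡true

select : ∀ {n} → Subset n → (Fin n → ℕ) → Fin n → ℕ
select S f i = if lookup S i then f i else 0

foldr-tabulate≡sum : ∀ {A : Set} {n} (g : A → ℕ) (h : Fin n → A) →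
  foldr (λ _ → ℕ) (λ a acc → g a + acc) 0 (tabulate h) ≡ sum (λ i → g (h i))
foldr-tabulate≡sum {n = zero} g h = refl
foldr-tabulate≡sum {n = suc n} g h = cong (g (h fzero) +_) (foldr-tabulate≡sum g (h ∘ fsuc))

sumOver≡sum : ∀ {n} (S : Subset n) f → sumOver S f ≡ sum (select S f)
sumOver≡sum S f = foldr-tabulate≡sum (select S f) (λ i → i)

sum-select-∁ : ∀ {n} (S : Subset n) f → sum (select S f) + sum (select (∁ S) f) ≡ sum f
sum-select-∁ [] f = refl
sum-select-∁ (true ∷ S) f =
  trans (+-assoc (f fzero) _ _) (cong (f fzero +_) (sum-select-∁ S (f ∘ fsuc)))
sum-select-∁ (false ∷ S) f =
  trans (x∙yz≈y∙xz (sum (select S (f ∘ fsuc))) (f fzero) _) (cong (f fzero +_) (sum-select-∁ S (f ∘ fsuc)))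

sumOver-∁ : ∀ {n} (S : Subset n) f → sumOver S f + sumOver (∁ S) f ≡ N f
sumOver-∁ S f = begin
  sumOver S f + sumOver (∁ S) f            ≡⟨ cong₂ _+_ (sumOver≡sum S f) (sumOver≡sum (∁ S) f) ⟩
  sum (select S f) + sum (select (∁ S) f)  ≡⟨ sum-select-∁ S f ⟩
  sum f                                    ≡⟨ foldr-tabulate≡sum f (λ i → i) ⟨
  N f                                      ∎
  where open ≡-Reasoning

sum-select-≤ : ∀ {n} (S : Subset n) {f m} → (∀ i → f i ≤ m) → sum (select S f) ≤ ∣ S ∣ * m
sum-select-≤ [] f≤m = z≤n
sum-select-≤ (true ∷ S) f≤m = +-mono-≤ (f≤m fzero) (sum-select-≤ S (f≤m ∘ fsuc))
sum-select-≤ (false ∷ S) f≤m = sum-select-≤ S (f≤m ∘ fsuc)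

sumOver-≤ : ∀ {n} (S : Subset n) {f m} → (∀ i → f i ≤ m) → sumOver S f ≤ ∣ S ∣ * m
sumOver-≤ S {f} f≤m = subst (_≤ _) (sym (sumOver≡sum S f)) (sum-select-≤ S f≤m)

sum-select-∅ : ∀ {n} (S : Subset n) f → ∣ S ∣ ≡ 0 → sum (select S f) ≡ 0
sum-select-∅ [] f _ = refl
sum-select-∅ (false ∷ S) f ∣S∣≡0 = sum-select-∅ S (f ∘ fsuc) ∣S∣≡0

sumOver-∅ : ∀ {n} (S : Subset n) f → ∣ S ∣ ≡ 0 → sumOver S f ≡ 0
sumOver-∅ S f ∣S∣≡0 = trans (sumOver≡sum S f) (sum-select-∅ S f ∣S∣≡0)

∣p∣+∣q─p∣≡∣q∣ : ∀ {n} {p q : Subset n} → p ⊆ q → ∣ p ∣ + ∣ q ─ p ∣ ≡ ∣ q ∣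
∣p∣+∣q─p∣≡∣q∣ {p = []} {[]} _ = refl
∣p∣+∣q─p∣≡∣q∣ {p = true ∷ p} {true ∷ q} p⊆q = cong suc (∣p∣+∣q─p∣≡∣q∣ (drop-∷-⊆ p⊆q))
∣p∣+∣q─p∣≡∣q∣ {p = true ∷ p} {false ∷ q} p⊆q with () ← p⊆q here
∣p∣+∣q─p∣≡∣q∣ {p = false ∷ p} {true ∷ q} p⊆q = trans (+-suc ∣ p ∣ _) (cong suc (∣p∣+∣q─p∣≡∣q∣ (drop-∷-⊆ p⊆q)))
∣p∣+∣q─p∣≡∣q∣ {p = false ∷ p} {false ∷ q} p⊆q = ∣p∣+∣q─p∣≡∣q∣ (drop-∷-⊆ p⊆q)

Unique⇒lookup-≢ : ∀ {A : Set} {xs : List A} → Unique xs →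
  ∀ {i j} → i ≢ j → List.lookup xs i ≢ List.lookup xs j
Unique⇒lookup-≢ (_ ∷ _) {fzero} {fzero} i≢j = ⊥-elim (i≢j refl)
Unique⇒lookup-≢ (x∉xs ∷ _) {fzero} {fsuc j} _ = All.lookup x∉xs (∈-lookup j)
Unique⇒lookup-≢ (x∉xs ∷ _) {fsuc i} {fzero} _ = ≢-sym (All.lookup x∉xs (∈-lookup i))
Unique⇒lookup-≢ (_ ∷ u) {fsuc i} {fsuc j} i≢j = Unique⇒lookup-≢ u (i≢j ∘ cong fsuc)

Unique⇒length≤ : ∀ {A : Set} {xs : List A} {m} (f : A → Fin m) → Unique xs →
  (∀ {x y} → x ∈ˡ xs → y ∈ˡ xs → x ≢ y → f x ≢ f y) → length xs ≤ m
Unique⇒length≤ {xs = xs} {m} f u f-separates with length xs ≤? m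
... | yes length≤m = length≤m
... | no length≰m with pigeonhole (≰⇒> length≰m) (f ∘ List.lookup xs)
...   | i , j , i<j , fᵢ≡fⱼ =
  contradiction fᵢ≡fⱼ (f-separates (∈-lookup i) (∈-lookup j) (Unique⇒lookup-≢ u (FinP.<⇒≢ i<j)))

vecToFin : ∀ {q m} → Vec (Fin q) m → Fin (q ^ m)
vecToFin v = funToFin (lookup v)

vecToFin-injective : ∀ {q m} → Injective _≡_ _≡_ (vecToFin {q} {m})
vecToFin-injective {x = u} {v} eq = begin
  u                   ≡⟨ tabulate∘lookup u ⟨
  tabulate (lookup u) ≡⟨ tabulate-cong lookup-u≗v ⟩
  tabulate (lookup v) ≡⟨ tabulate∘lookup v ⟩
  v                   ∎
  where
  open ≡-Reasoning
  lookup-u≗v : ∀ i → lookup u i ≡ lookup v i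
  lookup-u≗v i = begin
    lookup u i                      ≡⟨ finToFun-funToFin (lookup u) i ⟨
    finToFun (vecToFin u) i         ≡⟨ cong (λ c → finToFun c i) eq ⟩
    finToFun (vecToFin v) i         ≡⟨ finToFun-funToFin (lookup v) i ⟩
    lookup v i                      ∎

keep : ∀ {A : Set} {m} (b : Bool) → Vec A m → Vec A (if b then m else 0)
keep true v = v
keep false _ = []

flatten : ∀ {A : Set} {n} {ks : Fin n → ℕ} → ((i : Fin n) → Vec A (ks i)) → Vec A (sum ks)
flatten {n = zero} g = []
flatten {n = suc n} g = g fzero ++ flatten (g ∘ fsuc)

flatten-injective : ∀ {A : Set} {n} {ks : Fin n → ℕ} (g h : (i : Fin n) → Vec A (ks i)) →
  flatten g ≡ flatten h → ∀ i → g i ≡ h i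
flatten-injective {n = suc n} g h eq fzero = ++-injectiveˡ (g fzero) (h fzero) eq
flatten-injective {n = suc n} g h eq (fsuc i) =
  flatten-injective (g ∘ fsuc) (h ∘ fsuc) (++-injectiveʳ (g fzero) (h fzero) eq) i

project : ∀ {q n k} (S : Subset n) → Word q n k → Vec (Fin q) (sum (select S k))
project S x = flatten (λ i → keep (lookup S i) (x i))

project-injective : ∀ {q n k} (S : Subset n) (x y : Word q n k) →
  project S x ≡ project S y → ∀ i → i ∈ S → x i ≡ y i
project-injective S x y eq i i∈S with lookup S i | []=⇒lookup i∈S | flatten-injective _ _ eq i
... | true | refl | xᵢ≡yᵢ = xᵢ≡yᵢ

module _ {q n} {F : FiniteField q} (W : Weight F) (P : FinPoset n) (k : Fin n → ℕ) where
  open FiniteField F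
  open Weight W
  open FinPoset P
  open IsCommutativeRing isCommutativeRing using (-‿inverseʳ)

  w≤Mw : ∀ α → w α ≤ Mw W
  w≤Mw = foldr-⊔-tabulate-≥ w (λ α → α)

  w̃≤Mw : ∀ {m} (v : Vec (Fin q) m) → w̃ W v ≤ Mw W
  w̃≤Mw [] = z≤n
  w̃≤Mw (a ∷ v) = ⊔-lub (w≤Mw a) (w̃≤Mw v)

  Mx⊆Ix : ∀ x → Mx W P k x ⊆ Ix W P k x
  Mx⊆Ix x {i} i∈Mx = lookup⇒[]= i _
    (∧-conicalˡ _ _ (trans (sym (lookup∘tabulate _ i)) ([]=⇒lookup i∈Mx)))

  nonzeroBlock : ∀ x {i} → i ∈ suppπ W P k x → x i ≢ replicate (k i) 0F
  nonzeroBlock x {i} i∈supp with ≡-dec FinP._≟_ (x i) (replicate (k i) 0F)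
                               | trans (sym (lookup∘tabulate _ i)) ([]=⇒lookup i∈supp)
  ... | no xᵢ≢0 | _ = xᵢ≢0

  Ix⊆ideal : ∀ x {J} → IsIdeal P J → suppπ W P k x ⊆ J → Ix W P k x ⊆ J
  Ix⊆ideal x {J} J-ideal supp⊆J {i} i∈Ix
    with foldr-∨-tabulate-true (λ j → isNonzeroBlock W P k x j ∧ does (i ≼? j)) (λ j → j)
           (trans (sym (lookup∘tabulate _ i)) ([]=⇒lookup i∈Ix))
  ... | j , nonzero∧≼ = J-ideal i j (supp⊆J j∈supp) (does≡true⇒ (i ≼? j) ≼ᵇ)
    where
    ≼ᵇ : does (i ≼? j) ≡ true
    ≼ᵇ = ∧-conicalʳ (isNonzeroBlock W P k x j) _ nonzero∧≼
    j∈supp : j ∈ suppπ W P k x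
    j∈supp = lookup⇒[]= j _ (trans (lookup∘tabulate _ j) (∧-conicalˡ _ _ nonzero∧≼))

  wPwπ≤∣Ix∣*Mw : ∀ x → wPwπ W P k x ≤ ∣ Ix W P k x ∣ * Mw W
  wPwπ≤∣Ix∣*Mw x = begin
    sumOver Mₓ (λ i → w̃ W (x i)) + ∣ Iₓ ─ Mₓ ∣ * Mw W  ≤⟨ +-monoˡ-≤ _ (sumOver-≤ Mₓ (λ i → w̃≤Mw (x i))) ⟩
    ∣ Mₓ ∣ * Mw W + ∣ Iₓ ─ Mₓ ∣ * Mw W               ≡⟨ *-distribʳ-+ (Mw W) ∣ Mₓ ∣ _ ⟨
    (∣ Mₓ ∣ + ∣ Iₓ ─ Mₓ ∣) * Mw W                    ≡⟨ cong (_* Mw W) (∣p∣+∣q─p∣≡∣q∣ (Mx⊆Ix x)) ⟩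
    ∣ Iₓ ∣ * Mw W                                   ∎
    where
    open ≤-Reasoning
    Iₓ Mₓ : Subset n
    Iₓ = Ix W P k x
    Mₓ = Mx W P k x

  zipWith-─-self : ∀ {m} (v : Vec (Fin q) m) → zipWith _-F_ v v ≡ replicate m 0F
  zipWith-─-self [] = refl
  zipWith-─-self (a ∷ v) = cong₂ _∷_ (-‿inverseʳ a) (zipWith-─-self v)

  dPwπ≤∣J∣*Mw : ∀ {J} → IsIdeal P J → ∀ c₁ c₂ → (∀ i → i ∈ ∁ J → c₁ i ≡ c₂ i) →
    dPwπ W P k c₁ c₂ ≤ ∣ J ∣ * Mw W
  dPwπ≤∣J∣*Mw {J} J-ideal c₁ c₂ agree = begin
    wPwπ W P k x            ≤⟨ wPwπ≤∣Ix∣*Mw x ⟩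
    ∣ Ix W P k x ∣ * Mw W    ≤⟨ *-monoˡ-≤ (Mw W) (p⊆q⇒∣p∣≤∣q∣ (Ix⊆ideal x J-ideal supp⊆J)) ⟩
    ∣ J ∣ * Mw W             ∎
    where
    open ≤-Reasoning
    x : Word q n k
    x i = zipWith _-F_ (c₁ i) (c₂ i)
    supp⊆J : suppπ W P k x ⊆ J
    supp⊆J {i} i∈supp with i ∈? J
    ... | yes i∈J = i∈J
    ... | no i∉J = contradiction
      (trans (cong (λ v → zipWith _-F_ v (c₂ i)) (agree i (x∉p⇒x∈∁p i∉J))) (zipWith-─-self (c₂ i)))
      (nonzeroBlock x i∈supp)

  length≤q^sumOver∁ : (C : List (Word q n k)) → Unique C → ∀ {d} → IsMinDist W P k C d →
    ∀ {J} → IsIdeal P J → ∣ J ∣ * Mw W < d → length C ≤ q ^ sumOver (∁ J) k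
  length≤q^sumOver∁ C unique {d} (_ , d≤dist) {J} J-ideal ∣J∣*Mw<d =
    subst (λ e → length C ≤ q ^ e) (sym (sumOver≡sum (∁ J) k))
      (Unique⇒length≤ (vecToFin ∘ project (∁ J)) unique separated)
    where
    separated : ∀ {c₁ c₂} → c₁ ∈ˡ C → c₂ ∈ˡ C → c₁ ≢ c₂ →
      vecToFin (project (∁ J) c₁) ≢ vecToFin (project (∁ J) c₂)
    separated {c₁} {c₂} c₁∈C c₂∈C c₁≢c₂ same-projection = <⇒≱ ∣J∣*Mw<d (begin
      d                 ≤⟨ d≤dist c₁ c₂ c₁∈C c₂∈C c₁≢c₂ ⟩
      dPwπ W P k c₁ c₂  ≤⟨ dPwπ≤∣J∣*Mw J-ideal c₁ c₂ agree ⟩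
      ∣ J ∣ * Mw W      ∎)
      where
      open ≤-Reasoning
      agree : ∀ i → i ∈ ∁ J → c₁ i ≡ c₂ i
      agree = project-injective (∁ J) c₁ c₂ (vecToFin-injective same-projection)

⌊0/m⌋≡0 : ∀ m → ⌊ 0 / m ⌋ ≡ 0
⌊0/m⌋≡0 zero = refl
⌊0/m⌋≡0 (suc m) = 0/n≡0 (suc m)

⌊a/m⌋*m≤a : ∀ a m → ⌊ a / m ⌋ * m ≤ a
⌊a/m⌋*m≤a a zero = z≤n
⌊a/m⌋*m≤a a (suc m) = m/n*n≤m a (suc m)

theorem4p1 : {q n : ℕ} (F : FiniteField q) (W : Weight F) (P : FinPoset n)
    (k : Fin n → ℕ) (C : List (Word q n k)) → Unique C → 2 ≤ length C →
    (d : ℕ) → IsMinDist W P k C d →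
    (J : Subset n) → IsIdeal P J → ∣ J ∣ ≡ ⌊ d ∸ 1 / Mw W ⌋ →
    sumOver J k ≤ N k ∸ ⌈log q ⌉ (length C)
theorem4p1 F W P k C unique _ zero _ J _ ∣J∣≡⌊d-1/Mw⌋ =
  subst (_≤ _) (sym (sumOver-∅ J k (trans ∣J∣≡⌊d-1/Mw⌋ (⌊0/m⌋≡0 (Mw W))))) z≤n
theorem4p1 {q} F W P k C unique _ (suc d) minDist J J-ideal ∣J∣≡⌊d-1/Mw⌋ =
  m+n≤o⇒m≤o∸n (sumOver J k) (begin
    sumOver J k + ⌈log q ⌉ (length C)  ≤⟨ +-monoʳ-≤ (sumOver J k) (⌈log⌉-least q code-size) ⟩
    sumOver J k + sumOver (∁ J) k      ≡⟨ sumOver-∁ J k ⟩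
    N k                                ∎)
  where
  open ≤-Reasoning
  ∣J∣*Mw<d : ∣ J ∣ * Mw W < suc d
  ∣J∣*Mw<d = s≤s (subst (λ j → j * Mw W ≤ d) (sym ∣J∣≡⌊d-1/Mw⌋) (⌊a/m⌋*m≤a d (Mw W)))
  code-size : length C ≤ q ^ sumOver (∁ J) k
  code-size = length≤q^sumOver∁ W P k C unique minDist J-ideal ∣J∣*Mw<d
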